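{- Let $p$ be a prime and let $\varphi(\sum_{n\ge0}\alpha_nX^n)=\sum_{n\ge0}\alpha_nX^{pn}$ on $\overline{\mathbb F}_p[[X]]$. Then $\exp_!(\varphi(A))=\varphi(\exp_!(A))$ for all $A\in X\overline{\mathbb F}_p[[X]]$ and $\log_!(\varphi(B))=\varphi(\log_!(B))$ for all $B\in1+X\overline{\mathbb F}_p[[X]]$.
   Context: $\exp_!(\sum_{n\ge1}\alpha_nX^n)=1+\sum_{n\ge1}\beta_nX^n$ where $\exp(\sum\alpha_nX^n/n!)=1+\sum\beta_nX^n/n!$ computed formally over $\mathbb Z$ (the $\beta_n$ being integer polynomials in the $\alpha_i$) and reduced mod $p$; $\log_!$ is the inverse bijection $1+X\overline{\mathbb F}_p[[X]]\to X\overline{\mathbb F}_p[[X]]$. -}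

module Defs where

open import Level using (Level; _⊔_)
open import Algebra.Bundles using (CommutativeRing; Semiring)
import Algebra.Definitions.RawSemiring as RS
open import Data.Nat using (ℕ; zero; suc; _≤_)
open import Data.Nat.Divisibility using (_∣?_; divides)
open import Data.Nat.Combinatorics using (_C_)
open import Data.Fin using (Fin; toℕ)
open import Data.Vec using (Vec; []; _∷_; lookup; head)
open import Data.List using (List; []; _∷_; _++_; [_]; length)
open import Data.List.Relation.Unary.Any using (Any)
open import Data.Product using (Σ; _×_)
open import Relation.Nullary using (¬_; yes; no)

module _ {c ℓ : Level} (K : CommutativeRing c ℓ) where
  open CommutativeRing K renaming (Carrier to F)
  open RS (Semiring.rawSemiring semiring) using (sum) renaming (_×_ to _×ℕ_)

  Series : Set c
  Series = ℕ → F

  _≈ₛ_ : Series → Series → Set ℓ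
  A ≈ₛ B = ∀ n → A n ≈ B n

  -- evaluation of a polynomial (coefficient list, constant term first)
  eval : List F → F → F
  eval []       x = 0#
  eval (a ∷ as) x = a + x * eval as x

  IsField : Set (c ⊔ ℓ)
  IsField = (¬ (0# ≈ 1#)) × (∀ x → ¬ (x ≈ 0#) → Σ F λ y → x * y ≈ 1#)

  -- algebraically closed: every monic polynomial of degree ≥ 1 has a root
  IsAlgClosed : Set (c ⊔ ℓ)
  IsAlgClosed = ∀ (cs : List F) → 1 ≤ length cs →
                Σ F λ x → eval (cs ++ [ 1# ]) x ≈ 0#

  -- image of an integer polynomial (given by ℕ-coefficients, which suffices in
  -- characteristic p) in K[X]
  embedℕ : List ℕ → List F
  embedℕ []       = []
  embedℕ (n ∷ ns) = (n ×ℕ 1#) ∷ embedℕ ns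

  IsAlgebraicOverPrimeField : Set (c ⊔ ℓ)
  IsAlgebraicOverPrimeField = ∀ x → Σ (List ℕ) λ ns →
    Any (λ n → ¬ ((n ×ℕ 1#) ≈ 0#)) ns × (eval (embedℕ ns) x ≈ 0#)

  -- K is an algebraic closure of F_p (characteristic p, algebraically closed,
  -- algebraic over its prime field) — this characterises \bar F_p
  IsAlgebraicClosureOfFp : ℕ → Set (c ⊔ ℓ)
  IsAlgebraicClosureOfFp p =
    IsField × (p ×ℕ 1# ≈ 0#) × IsAlgClosed × IsAlgebraicOverPrimeField

  φ : ℕ → Series → Series
  φ p A n with p ∣? n
  ... | yes (divides q _) = A q
  ... | no _              = 0#

  -- The polynomials βₙ of exp(Σ αₙ Xⁿ/n!) = 1 + Σ βₙ Xⁿ/n! (complete Bell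
  -- polynomials), computed over ℤ by the recurrence coming from g' = f' g:
  --   β₀ = 1,  β_{n+1} = Σ_{k=0}^{n} C(n,k) α_{k+1} β_{n-k},
  -- and evaluated in K (i.e. reduced mod p).
  -- betaTable α n = [βₙ , β_{n-1} , … , β₀]
  betaTable : Series → (n : ℕ) → Vec F (suc n)
  betaTable α zero    = 1# ∷ []
  betaTable α (suc n) =
    sum (λ (k : Fin (suc n)) →
           (n C toℕ k) ×ℕ (α (suc (toℕ k)) * lookup (betaTable α n) k))
    ∷ betaTable α n

  -- exp_!(Σ_{n≥1} αₙ Xⁿ) = 1 + Σ_{n≥1} βₙ Xⁿ
  exp! : Series → Series
  exp! α n = head (betaTable α n)

  -- L is log_!, the inverse bijection of exp_! : X K[[X]] → 1 + X K[[X]]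
  IsLog! : (Series → Series) → Set (c ⊔ ℓ)
  IsLog! L =
    (∀ B → B 0 ≈ 1# → L B 0 ≈ 0#) ×
    (∀ B → B 0 ≈ 1# → exp! (L B) ≈ₛ B) ×
    (∀ A → A 0 ≈ 0# → L (exp! A) ≈ₛ A)

{-# OPTIONS --safe #-}
-- Write p = r + 1 and run the recurrence β_{m+1} = Σ_{k≤m} C(m,k) α_{k+1} β_{m−k} of exp_! on φ(α),
-- by strong induction on m. If p ∤ m + 1, every summand has a factor at an index prime to p, so it
-- vanishes. If m + 1 = (n + 1) p, only the summands with k = j p + r survive, and by Lucas'
-- congruence C(n p + r, j p + r) ≡ C(n, j) mod p they are exactly the summands of β_{n+1}.
-- For log_!, exp_! is injective on X K[[X]] because α_{m+1} enters β_{m+1} with coefficient 1.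
module Submission where

open import Defs
open import Level using (Level)
open import Algebra.Bundles using (CommutativeRing; Monoid; Semiring)
open import Data.Nat as ℕ using (ℕ; zero; suc; _<_; z≤n; s≤s; NonZero)
import Data.Nat.Properties as ℕ
open import Data.Nat.Divisibility using (_∣_; _∣?_; divides; ∣⇒≤; ∣m∣n⇒∣m+n; ∣m+n∣m⇒∣n; n∣m*n)
open import Data.Nat.Primality using (Prime; prime⇒nonZero)
open import Data.Nat.Combinatorics using (_C_)
open import Data.Nat.Induction using (<-rec)
open import Data.Fin using (Fin; toℕ) renaming (zero to fzero; suc to fsuc)
open import Data.Vec using (lookup)
open import Data.Product using (_×_; _,_)
open import Data.Empty using (⊥-elim)
open import Function using (_∘_)
open import Relation.Nullary using (¬_; Dec; yes; no)
open import Relation.Binary.PropositionalEquality as ≡ using (_≡_; cong)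

module Binomial where
  open import Data.Nat
  open import Data.Nat.Properties
  open import Data.Nat.Combinatorics using (k>n⇒nCk≡0; nCk+nC[k+1]≡[n+1]C[k+1]; nCk≡nC[n∸k]; nCn≡1)
  open import Data.Nat.Divisibility using (m∣m*n)
  open import Data.Nat.Primality using (euclidsLemma)
  open import Data.Sum using (inj₁; inj₂)
  open ≡ using (refl; sym; trans; cong₂; subst)
  open ≡.≡-Reasoning

  infixl 6.5 _choose_

  _choose_ : ℕ → ℕ → ℕ
  zero  choose zero  = 1
  zero  choose suc k = 0
  suc n choose zero  = 1
  suc n choose suc k = n choose k + n choose suc k

  choose-zeroʳ : ∀ n → n choose 0 ≡ 1
  choose-zeroʳ zero    = refl
  choose-zeroʳ (suc n) = refl

  choose-oneʳ : ∀ n → n choose 1 ≡ n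
  choose-oneʳ zero    = refl
  choose-oneʳ (suc n) = cong₂ _+_ (choose-zeroʳ n) (choose-oneʳ n)

  choose-above : ∀ {n k} → n < k → n choose k ≡ 0
  choose-above {zero}  {suc k} _         = refl
  choose-above {suc n} {suc k} (s≤s n<k) =
    cong₂ _+_ (choose-above n<k) (choose-above (m<n⇒m<1+n n<k))

  choose-diagonal : ∀ n → n choose n ≡ 1
  choose-diagonal zero    = refl
  choose-diagonal (suc n) = cong₂ _+_ (choose-diagonal n) (choose-above (n<1+n n))

  choose≡C : ∀ n k → n choose k ≡ n C k
  choose≡C zero    zero    = refl
  choose≡C zero    (suc k) = sym (k>n⇒nCk≡0 {0} {suc k} (s≤s z≤n))
  choose≡C (suc n) zero    = sym (trans (nCk≡nC[n∸k] {k = 0} {n = suc n} z≤n) (nCn≡1 (suc n)))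
  choose≡C (suc n) (suc k) =
    trans (cong₂ _+_ (choose≡C n k) (choose≡C n (suc k))) (nCk+nC[k+1]≡[n+1]C[k+1] n k)

  suc-*-choose : ∀ n k → suc k * (suc n choose suc k) ≡ suc n * (n choose k)
  suc-*-choose zero    zero    = refl
  suc-*-choose zero    (suc k) = *-zeroʳ (suc (suc k))
  suc-*-choose (suc n) zero    =
    trans (*-identityˡ _) (trans (choose-oneʳ (suc (suc n))) (sym (*-identityʳ _)))
  suc-*-choose (suc n) (suc k) = begin
    suc (suc k) * (x + y)                            ≡⟨ *-distribˡ-+ (suc (suc k)) x y ⟩
    suc (suc k) * x + suc (suc k) * y                ≡⟨ cong (suc (suc k) * x +_) (suc-*-choose n (suc k)) ⟩
    (x + suc k * x) + suc n * (n choose suc k)       ≡⟨ cong (λ z → (x + z) + suc n * (n choose suc k)) (suc-*-choose n k) ⟩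
    (x + suc n * (n choose k)) + suc n * (n choose suc k) ≡⟨ +-assoc x _ _ ⟩
    x + (suc n * (n choose k) + suc n * (n choose suc k)) ≡⟨ cong (x +_) (*-distribˡ-+ (suc n) (n choose k) (n choose suc k)) ⟨
    x + suc n * x                                    ∎
    where
    x = n choose k + n choose suc k
    y = n choose suc k + n choose suc (suc k)

  prime∣choose : ∀ {p k} → Prime p → suc k < p → p ∣ p choose suc k
  prime∣choose {suc r} {k} p-prime (s≤s k<r)
    with euclidsLemma (suc k) (suc r choose suc k) p-prime
           (subst (suc r ∣_) (sym (suc-*-choose r k)) (m∣m*n (r choose k)))
  ... | inj₂ p∣choose = p∣choose
  ... | inj₁ p∣suc-k  = ⊥-elim (<-irrefl refl (≤-trans (∣⇒≤ p∣suc-k) k<r))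

open Binomial using (_choose_; choose-zeroʳ; choose-above; choose-diagonal; choose≡C; prime∣choose)

module FiniteSums {a ℓ} (M : Monoid a ℓ) where
  open Monoid M renaming (Carrier to A; _∙_ to _+_; ε to 0#; identityˡ to +-identityˡ; identityʳ to +-identityʳ; assoc to +-assoc; ∙-cong to +-cong; ∙-congˡ to +-congˡ)
  open import Algebra.Definitions.RawMonoid rawMonoid using (sum)
  open import Relation.Binary.Reasoning.Setoid setoid

  ∑< : ℕ → (ℕ → A) → A
  ∑< zero    f = 0#
  ∑< (suc n) f = f 0 + ∑< n (f ∘ suc)

  sum≈∑< : ∀ n (f : Fin n → A) (g : ℕ → A) → (∀ k → f k ≈ g (toℕ k)) → sum f ≈ ∑< n g
  sum≈∑< zero    f g f≈g = refl
  sum≈∑< (suc n) f g f≈g = +-cong (f≈g fzero) (sum≈∑< n (f ∘ fsuc) (g ∘ suc) (f≈g ∘ fsuc))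

  ∑<-cong : ∀ n f g → (∀ k → k < n → f k ≈ g k) → ∑< n f ≈ ∑< n g
  ∑<-cong zero    f g f≈g = refl
  ∑<-cong (suc n) f g f≈g =
    +-cong (f≈g 0 (s≤s z≤n)) (∑<-cong n (f ∘ suc) (g ∘ suc) (λ k k<n → f≈g (suc k) (s≤s k<n)))

  ∑<-zero : ∀ n f → (∀ k → k < n → f k ≈ 0#) → ∑< n f ≈ 0#
  ∑<-zero zero    f f≈0 = refl
  ∑<-zero (suc n) f f≈0 =
    trans (+-cong (f≈0 0 (s≤s z≤n)) (∑<-zero n (f ∘ suc) (λ k k<n → f≈0 (suc k) (s≤s k<n))))
          (+-identityˡ 0#)

  ∑<-+ : ∀ m n f → ∑< (m ℕ.+ n) f ≈ ∑< m f + ∑< n (λ i → f (m ℕ.+ i))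
  ∑<-+ zero    n f = sym (+-identityˡ _)
  ∑<-+ (suc m) n f = trans (+-congˡ (∑<-+ m n (f ∘ suc))) (sym (+-assoc _ _ _))

  ∑<-snoc : ∀ n f → ∑< (suc n) f ≈ ∑< n f + f n
  ∑<-snoc n f = begin
    ∑< (suc n) f              ≈⟨ reflexive (cong (λ m → ∑< m f) (ℕ.+-comm 1 n)) ⟩
    ∑< (n ℕ.+ 1) f            ≈⟨ ∑<-+ n 1 f ⟩
    ∑< n f + (f (n ℕ.+ 0) + 0#) ≈⟨ +-congˡ (trans (+-identityʳ _) (reflexive (cong f (ℕ.+-identityʳ n)))) ⟩
    ∑< n f + f n              ∎

  ∑<-last : ∀ r f → (∀ i → i < r → f i ≈ 0#) → ∑< (suc r) f ≈ f r
  ∑<-last zero    f _   = +-identityʳ _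
  ∑<-last (suc r) f f≈0 =
    trans (+-cong (f≈0 0 (s≤s z≤n)) (∑<-last r (f ∘ suc) (λ i i<r → f≈0 (suc i) (s≤s i<r))))
          (+-identityˡ _)

  ∑<-last-of-blocks : ∀ r N f → (∀ j i → i < r → f (j ℕ.* suc r ℕ.+ i) ≈ 0#) →
                      ∑< (N ℕ.* suc r) f ≈ ∑< N (λ j → f (j ℕ.* suc r ℕ.+ r))
  ∑<-last-of-blocks r zero    f f≈0 = refl
  ∑<-last-of-blocks r (suc N) f f≈0 = begin
    ∑< (p ℕ.+ N ℕ.* p) f                                 ≈⟨ ∑<-+ p (N ℕ.* p) f ⟩
    ∑< p f + ∑< (N ℕ.* p) (λ k → f (p ℕ.+ k))             ≈⟨ +-cong (∑<-last r f (f≈0 0)) (∑<-last-of-blocks r N (λ k → f (p ℕ.+ k)) shifted≈0) ⟩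
    f r + ∑< N (λ j → f (p ℕ.+ (j ℕ.* p ℕ.+ r)))          ≈⟨ +-congˡ (∑<-cong N _ _ (λ j _ → reflexive (cong f (≡.sym (ℕ.+-assoc p (j ℕ.* p) r))))) ⟩
    ∑< (suc N) (λ j → f (j ℕ.* p ℕ.+ r))                 ∎
    where
    p : ℕ
    p = suc r
    shifted≈0 : ∀ j i → i < r → f (p ℕ.+ (j ℕ.* p ℕ.+ i)) ≈ 0#
    shifted≈0 j i i<r = trans (reflexive (cong f (≡.sym (ℕ.+-assoc p (j ℕ.* p) i)))) (f≈0 (suc j) i i<r)

module CharacteristicBinomials {a ℓ} (S : Semiring a ℓ) where
  open Semiring S hiding (zero)
  open import Algebra.Properties.Semiring.Mult S renaming (_×_ to _×ℕ_)
  open import Algebra.Properties.CommutativeSemigroup +-commutativeSemigroup using (interchange)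
  open import Relation.Binary.Reasoning.Setoid setoid

  ⟦_⟧ : ℕ → Carrier
  ⟦ n ⟧ = n ×ℕ 1#

  ⟦⟧-*≈× : ∀ n x → ⟦ n ⟧ * x ≈ n ×ℕ x
  ⟦⟧-*≈× n x = trans (×-assoc-* n 1# x) (×-congʳ n (*-identityˡ x))

  ⟦⟧-+ : ∀ m n → ⟦ m ℕ.+ n ⟧ ≈ ⟦ m ⟧ + ⟦ n ⟧
  ⟦⟧-+ m n = ×-homo-+ 1# m n

  ⟦1⟧ : ∀ {n} → n ≡ 1 → ⟦ n ⟧ ≈ 1#
  ⟦1⟧ ≡.refl = +-identityʳ 1#

  ⟦0⟧ : ∀ {n} → n ≡ 0 → ⟦ n ⟧ ≈ 0#
  ⟦0⟧ ≡.refl = refl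

  -- Parametrised by r = p − 1, so that indices split into blocks as j * p + i with i ≤ r.
  module _ {r} (p-prime : Prime (suc r)) (char : ⟦ suc r ⟧ ≈ 0#) where
    private
      p : ℕ
      p = suc r

      next-block : ∀ n → suc n ℕ.* p ℕ.+ r ≡ (n ℕ.* p ℕ.+ r) ℕ.+ p
      next-block n = ≡.trans (ℕ.+-assoc p (n ℕ.* p) r) (ℕ.+-comm p (n ℕ.* p ℕ.+ r))

    ⟦choose⟧ : ℕ → ℕ → Carrier
    ⟦choose⟧ m k = ⟦ m choose k ⟧

    prime-choose≈0 : ∀ i → i < r → ⟦choose⟧ p (suc i) ≈ 0#
    prime-choose≈0 i i<r with prime∣choose p-prime (s≤s i<r)
    ... | divides q eq = begin
      ⟦ p choose suc i ⟧ ≈⟨ reflexive (cong ⟦_⟧ eq) ⟩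
      ⟦ q ℕ.* p ⟧        ≈⟨ ×1-homo-* q p ⟩
      ⟦ q ⟧ * ⟦ p ⟧      ≈⟨ *-congˡ char ⟩
      ⟦ q ⟧ * 0#         ≈⟨ zeroʳ _ ⟩
      0#                 ∎

    -- The two shift rules say (1 + X)^(m+p) = (1 + X)^m (1 + X^p) coefficientwise.
    choose-+p-below : ∀ m k → k < p → ⟦choose⟧ (m ℕ.+ p) k ≈ ⟦choose⟧ m k
    choose-+p-below zero    zero    _         = refl
    choose-+p-below zero    (suc k) (s≤s k<r) = prime-choose≈0 k k<r
    choose-+p-below (suc m) zero    _         = refl
    choose-+p-below (suc m) (suc k) (s≤s k<r) = begin
      ⟦ (m ℕ.+ p) choose k ℕ.+ (m ℕ.+ p) choose suc k ⟧     ≈⟨ ⟦⟧-+ ((m ℕ.+ p) choose k) _ ⟩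
      ⟦choose⟧ (m ℕ.+ p) k + ⟦choose⟧ (m ℕ.+ p) (suc k)     ≈⟨ +-cong (choose-+p-below m k (ℕ.m<n⇒m<1+n k<r)) (choose-+p-below m (suc k) (s≤s k<r)) ⟩
      ⟦choose⟧ m k + ⟦choose⟧ m (suc k)                     ≈⟨ ⟦⟧-+ (m choose k) _ ⟨
      ⟦choose⟧ (suc m) (suc k)                              ∎

    choose-+p-+p : ∀ m k → ⟦choose⟧ (m ℕ.+ p) (k ℕ.+ p) ≈ ⟦choose⟧ m (k ℕ.+ p) + ⟦choose⟧ m k
    choose-+p-+p zero zero = begin
      ⟦choose⟧ p p                 ≈⟨ ⟦1⟧ (choose-diagonal p) ⟩
      1#                           ≈⟨ +-identityˡ 1# ⟨
      0# + 1#                      ≈⟨ +-congˡ (⟦1⟧ ≡.refl) ⟨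
      ⟦choose⟧ 0 p + ⟦choose⟧ 0 0  ∎
    choose-+p-+p zero (suc k) = begin
      ⟦choose⟧ p (suc k ℕ.+ p)                 ≈⟨ ⟦0⟧ (choose-above (s≤s (ℕ.m≤n+m p k))) ⟩
      0#                                       ≈⟨ +-identityˡ 0# ⟨
      ⟦choose⟧ 0 (suc k ℕ.+ p) + ⟦choose⟧ 0 (suc k) ∎
    choose-+p-+p (suc m) zero = begin
      ⟦ (m ℕ.+ p) choose r ℕ.+ (m ℕ.+ p) choose p ⟧    ≈⟨ ⟦⟧-+ ((m ℕ.+ p) choose r) _ ⟩
      ⟦choose⟧ (m ℕ.+ p) r + ⟦choose⟧ (m ℕ.+ p) p      ≈⟨ +-cong (choose-+p-below m r (ℕ.n<1+n r)) (choose-+p-+p m zero) ⟩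
      ⟦choose⟧ m r + (⟦choose⟧ m p + ⟦choose⟧ m 0)     ≈⟨ +-assoc _ _ _ ⟨
      (⟦choose⟧ m r + ⟦choose⟧ m p) + ⟦choose⟧ m 0     ≈⟨ +-cong (⟦⟧-+ (m choose r) _) (reflexive (cong ⟦_⟧ (≡.sym (choose-zeroʳ m)))) ⟨
      ⟦choose⟧ (suc m) p + ⟦choose⟧ (suc m) 0          ∎
    choose-+p-+p (suc m) (suc k) = begin
      ⟦ (m ℕ.+ p) choose (k ℕ.+ p) ℕ.+ (m ℕ.+ p) choose suc (k ℕ.+ p) ⟧
        ≈⟨ ⟦⟧-+ ((m ℕ.+ p) choose (k ℕ.+ p)) _ ⟩
      ⟦choose⟧ (m ℕ.+ p) (k ℕ.+ p) + ⟦choose⟧ (m ℕ.+ p) (suc k ℕ.+ p)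
        ≈⟨ +-cong (choose-+p-+p m k) (choose-+p-+p m (suc k)) ⟩
      (⟦choose⟧ m (k ℕ.+ p) + ⟦choose⟧ m k) + (⟦choose⟧ m (suc k ℕ.+ p) + ⟦choose⟧ m (suc k))
        ≈⟨ interchange _ _ _ _ ⟩
      (⟦choose⟧ m (k ℕ.+ p) + ⟦choose⟧ m (suc k ℕ.+ p)) + (⟦choose⟧ m k + ⟦choose⟧ m (suc k))
        ≈⟨ +-cong (⟦⟧-+ (m choose (k ℕ.+ p)) _) (⟦⟧-+ (m choose k) _) ⟨
      ⟦choose⟧ (suc m) (suc k ℕ.+ p) + ⟦choose⟧ (suc m) (suc k)
        ∎

    lucas : ∀ n j → ⟦choose⟧ (n ℕ.* p ℕ.+ r) (j ℕ.* p ℕ.+ r) ≈ ⟦choose⟧ n j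
    lucas zero zero = reflexive (cong ⟦_⟧ (choose-diagonal r))
    lucas zero (suc j) = ⟦0⟧ (choose-above (s≤s (ℕ.m≤n+m r (r ℕ.+ j ℕ.* p))))
    lucas (suc n) zero = begin
      ⟦choose⟧ (suc n ℕ.* p ℕ.+ r) r          ≈⟨ reflexive (cong (λ m → ⟦choose⟧ m r) (next-block n)) ⟩
      ⟦choose⟧ ((n ℕ.* p ℕ.+ r) ℕ.+ p) r      ≈⟨ choose-+p-below (n ℕ.* p ℕ.+ r) r (ℕ.n<1+n r) ⟩
      ⟦choose⟧ (n ℕ.* p ℕ.+ r) r              ≈⟨ lucas n zero ⟩
      ⟦choose⟧ n 0                            ≈⟨ reflexive (cong ⟦_⟧ (choose-zeroʳ n)) ⟩
      ⟦choose⟧ (suc n) 0                      ∎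
    lucas (suc n) (suc j) = begin
      ⟦choose⟧ (suc n ℕ.* p ℕ.+ r) (suc j ℕ.* p ℕ.+ r)
        ≈⟨ reflexive (≡.cong₂ ⟦choose⟧ (next-block n) (next-block j)) ⟩
      ⟦choose⟧ ((n ℕ.* p ℕ.+ r) ℕ.+ p) ((j ℕ.* p ℕ.+ r) ℕ.+ p)
        ≈⟨ choose-+p-+p (n ℕ.* p ℕ.+ r) (j ℕ.* p ℕ.+ r) ⟩
      ⟦choose⟧ (n ℕ.* p ℕ.+ r) ((j ℕ.* p ℕ.+ r) ℕ.+ p) + ⟦choose⟧ (n ℕ.* p ℕ.+ r) (j ℕ.* p ℕ.+ r)
        ≈⟨ +-cong (trans (reflexive (cong (⟦choose⟧ (n ℕ.* p ℕ.+ r)) (≡.sym (next-block j)))) (lucas n (suc j))) (lucas n j) ⟩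
      ⟦choose⟧ n (suc j) + ⟦choose⟧ n j
        ≈⟨ trans (+-comm _ _) (sym (⟦⟧-+ (n choose j) _)) ⟩
      ⟦choose⟧ (suc n) (suc j)
        ∎

module _ {c ℓ : Level} (K : CommutativeRing c ℓ) where
  open CommutativeRing K hiding (zero) renaming (Carrier to F)
  open FiniteSums +-monoid
  open CharacteristicBinomials semiring
  open import Algebra.Definitions.RawSemiring (Semiring.rawSemiring semiring) using () renaming (_×_ to _×ℕ_)
  open import Algebra.Properties.Group +-group using (∙-cancelˡ)
  open import Relation.Binary.Reasoning.Setoid setoid

  exp!-summand : Series K → ℕ → ℕ → F
  exp!-summand α m k = ⟦ m choose k ⟧ * (α (suc k) * exp! K α (m ℕ.∸ k))

  exp!-summand≈0ˡ : ∀ α m k → α (suc k) ≈ 0# → exp!-summand α m k ≈ 0#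
  exp!-summand≈0ˡ α m k α≈0 = trans (*-congˡ (trans (*-congʳ α≈0) (zeroˡ _))) (zeroʳ _)

  exp!-summand≈0ʳ : ∀ α m k → exp! K α (m ℕ.∸ k) ≈ 0# → exp!-summand α m k ≈ 0#
  exp!-summand≈0ʳ α m k β≈0 = trans (*-congˡ (trans (*-congˡ β≈0) (zeroʳ _))) (zeroʳ _)

  betaTable-lookup : ∀ α m (k : Fin (suc m)) → lookup (betaTable K α m) k ≡ exp! K α (m ℕ.∸ toℕ k)
  betaTable-lookup α zero    fzero    = ≡.refl
  betaTable-lookup α (suc m) fzero    = ≡.refl
  betaTable-lookup α (suc m) (fsuc k) = betaTable-lookup α m k

  exp!-suc : ∀ α m → exp! K α (suc m) ≈ ∑< (suc m) (exp!-summand α m)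
  exp!-suc α m = sum≈∑< (suc m) recurrence-term (exp!-summand α m) λ k →
    sym (trans (reflexive (≡.cong₂ (λ n b → ⟦ n ⟧ * (α (suc (toℕ k)) * b))
                                    (choose≡C m (toℕ k)) (≡.sym (betaTable-lookup α m k))))
               (⟦⟧-*≈× (m C toℕ k) _))
    where
    recurrence-term : Fin (suc m) → F
    recurrence-term k = (m C toℕ k) ×ℕ (α (suc (toℕ k)) * lookup (betaTable K α m) k)

  exp!-summand-diagonal : ∀ α m → exp!-summand α m m ≈ α (suc m)
  exp!-summand-diagonal α m = begin
    ⟦ m choose m ⟧ * (α (suc m) * exp! K α (m ℕ.∸ m)) ≈⟨ *-cong (⟦1⟧ (choose-diagonal m)) (*-congˡ (reflexive (cong (exp! K α) (ℕ.n∸n≡0 m)))) ⟩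
    1# * (α (suc m) * 1#)                            ≈⟨ trans (*-identityˡ _) (*-identityʳ _) ⟩
    α (suc m)                                        ∎

  -- β_{m+1} is α_{m+1} plus terms in α_1, …, α_m only.
  exp!-injective : ∀ α β → _≈ₛ_ K (exp! K α) (exp! K β) → ∀ m → α (suc m) ≈ β (suc m)
  exp!-injective α β exp-α≈exp-β = <-rec _ step
    where
    step : ∀ m → (∀ {k} → k < m → α (suc k) ≈ β (suc k)) → α (suc m) ≈ β (suc m)
    step m IH = ∙-cancelˡ (∑< m (exp!-summand α m)) _ _ (begin
      ∑< m (exp!-summand α m) + α (suc m)             ≈⟨ +-congˡ (exp!-summand-diagonal α m) ⟨
      ∑< m (exp!-summand α m) + exp!-summand α m m    ≈⟨ ∑<-snoc m _ ⟨
      ∑< (suc m) (exp!-summand α m)                   ≈⟨ exp!-suc α m ⟨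
      exp! K α (suc m)                                ≈⟨ exp-α≈exp-β (suc m) ⟩
      exp! K β (suc m)                                ≈⟨ exp!-suc β m ⟩
      ∑< (suc m) (exp!-summand β m)                   ≈⟨ ∑<-snoc m _ ⟩
      ∑< m (exp!-summand β m) + exp!-summand β m m    ≈⟨ +-cong (∑<-cong m _ _ earlier-summands) (exp!-summand-diagonal β m) ⟩
      ∑< m (exp!-summand α m) + β (suc m)             ∎)
      where
      earlier-summands : ∀ k → k < m → exp!-summand β m k ≈ exp!-summand α m k
      earlier-summands k k<m = *-congˡ (*-cong (sym (IH k<m)) (sym (exp-α≈exp-β (m ℕ.∸ k))))

  module _ (p : ℕ) .{{_ : NonZero p}} where

    φ-multiple : ∀ A {n} q → n ≡ q ℕ.* p → φ K p A n ≈ A q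
    φ-multiple A {n} q n≡qp with p ∣? n
    ... | yes (divides q′ n≡q′p) = reflexive (cong A (ℕ.*-cancelʳ-≡ q′ q p (≡.trans (≡.sym n≡q′p) n≡qp)))
    ... | no p∤n                 = ⊥-elim (p∤n (divides q n≡qp))

    φ-nonmultiple : ∀ A {n} → ¬ p ∣ n → φ K p A n ≈ 0#
    φ-nonmultiple A {n} p∤n with p ∣? n
    ... | yes p∣n = ⊥-elim (p∤n p∣n)
    ... | no _    = refl

    φ-cong : ∀ {A B} → _≈ₛ_ K A B → _≈ₛ_ K (φ K p A) (φ K p B)
    φ-cong A≈B n with p ∣? n
    ... | yes (divides q _) = A≈B q
    ... | no _              = refl

  module _ {r : ℕ} (p-prime : Prime (suc r)) (char : ⟦ suc r ⟧ ≈ 0#) where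
    private
      p : ℕ
      p = suc r

    φ-commutes-below : Series K → ℕ → Set ℓ
    φ-commutes-below α m = ∀ {k} → k < m → exp! K (φ K p α) k ≈ φ K p (exp! K α) k

    exp!-φ-nonmultiple : ∀ α m → φ-commutes-below α (suc m) →
                         ¬ p ∣ suc m → exp! K (φ K p α) (suc m) ≈ 0#
    exp!-φ-nonmultiple α m IH p∤suc-m = trans (exp!-suc (φ K p α) m) (∑<-zero (suc m) _ summand≈0)
      where
      -- (k + 1) + (m − k) = m + 1 is not a multiple of p, so one of the two indices is not either.
      summand≈0 : ∀ k → k < suc m → exp!-summand (φ K p α) m k ≈ 0#
      summand≈0 k (s≤s k≤m) = by-cases (p ∣? suc k)
        where
        by-cases : Dec (p ∣ suc k) → exp!-summand (φ K p α) m k ≈ 0#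
        by-cases (no p∤suc-k)  = exp!-summand≈0ˡ (φ K p α) m k (φ-nonmultiple p α p∤suc-k)
        by-cases (yes p∣suc-k) = exp!-summand≈0ʳ (φ K p α) m k
          (trans (IH (s≤s (ℕ.m∸n≤m m k))) (φ-nonmultiple p (exp! K α) p∤rest))
          where
          p∤rest : ¬ p ∣ m ℕ.∸ k
          p∤rest p∣rest = p∤suc-m (≡.subst (p ∣_) (cong suc (ℕ.m+[n∸m]≡n k≤m)) (∣m∣n⇒∣m+n p∣suc-k p∣rest))

    exp!-φ-multiple : ∀ α m n → φ-commutes-below α (suc m) →
                      suc m ≡ suc n ℕ.* p → exp! K (φ K p α) (suc m) ≈ exp! K α (suc n)
    exp!-φ-multiple α m n IH suc-m≡ = begin
      exp! K (φ K p α) (suc m)                                   ≈⟨ exp!-suc (φ K p α) m ⟩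
      ∑< (suc m) (exp!-summand (φ K p α) m)                      ≈⟨ reflexive (cong (λ l → ∑< l (exp!-summand (φ K p α) m)) suc-m≡) ⟩
      ∑< (suc n ℕ.* p) (exp!-summand (φ K p α) m)                ≈⟨ ∑<-last-of-blocks r (suc n) (exp!-summand (φ K p α) m) off-block≈0 ⟩
      ∑< (suc n) (λ j → exp!-summand (φ K p α) m (j ℕ.* p ℕ.+ r)) ≈⟨ ∑<-cong (suc n) (λ j → exp!-summand (φ K p α) m (j ℕ.* p ℕ.+ r)) (exp!-summand α n) block-end ⟩
      ∑< (suc n) (exp!-summand α n)                              ≈⟨ exp!-suc α n ⟨
      exp! K α (suc n)                                           ∎
      where
      m≡ : m ≡ n ℕ.* p ℕ.+ r
      m≡ = ≡.trans (ℕ.suc-injective suc-m≡) (ℕ.+-comm r (n ℕ.* p))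

      off-block≈0 : ∀ j i → i < r → exp!-summand (φ K p α) m (j ℕ.* p ℕ.+ i) ≈ 0#
      off-block≈0 j i i<r = exp!-summand≈0ˡ (φ K p α) m _ (φ-nonmultiple p α p∤index)
        where
        p∤index : ¬ p ∣ suc (j ℕ.* p ℕ.+ i)
        p∤index p∣ = ℕ.<-irrefl ≡.refl (ℕ.≤-trans (∣⇒≤ (∣m+n∣m⇒∣n (≡.subst (p ∣_) (≡.sym (ℕ.+-suc (j ℕ.* p) i)) p∣) (n∣m*n j))) i<r)

      rest≡ : ∀ j → m ℕ.∸ (j ℕ.* p ℕ.+ r) ≡ (n ℕ.∸ j) ℕ.* p
      rest≡ j = ≡.trans (cong (ℕ._∸ (j ℕ.* p ℕ.+ r)) m≡)
        (≡.trans (≡.cong₂ ℕ._∸_ (ℕ.+-comm (n ℕ.* p) r) (ℕ.+-comm (j ℕ.* p) r))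
        (≡.trans (ℕ.[m+n]∸[m+o]≡n∸o r (n ℕ.* p) (j ℕ.* p)) (≡.sym (ℕ.*-distribʳ-∸ p n j))))

      block-end : ∀ j → j < suc n → exp!-summand (φ K p α) m (j ℕ.* p ℕ.+ r) ≈ exp!-summand α n j
      block-end j _ = *-cong (trans (reflexive (cong (λ l → ⟦ l choose (j ℕ.* p ℕ.+ r) ⟧) m≡)) (lucas p-prime char n j))
                             (*-cong (φ-multiple p α (suc j) (cong suc (ℕ.+-comm (j ℕ.* p) r)))
                                     (trans (IH (s≤s (ℕ.m∸n≤m m (j ℕ.* p ℕ.+ r)))) (φ-multiple p (exp! K α) (n ℕ.∸ j) (rest≡ j))))

    exp!-φ : ∀ α → _≈ₛ_ K (exp! K (φ K p α)) (φ K p (exp! K α))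
    exp!-φ α = <-rec _ step
      where
      step : ∀ m → φ-commutes-below α m → exp! K (φ K p α) m ≈ φ K p (exp! K α) m
      step zero    _  = sym (φ-multiple p (exp! K α) 0 ≡.refl)
      step (suc m) IH = by-cases (p ∣? suc m)
        where
        by-cases : Dec (p ∣ suc m) → exp! K (φ K p α) (suc m) ≈ φ K p (exp! K α) (suc m)
        by-cases (no p∤suc-m)                = trans (exp!-φ-nonmultiple α m IH p∤suc-m) (sym (φ-nonmultiple p (exp! K α) p∤suc-m))
        by-cases (yes (divides (suc n) suc-m≡)) = trans (exp!-φ-multiple α m n IH suc-m≡) (sym (φ-multiple p (exp! K α) (suc n) suc-m≡))

    log!-φ : ∀ L → IsLog! K L → ∀ B → B 0 ≈ 1# → _≈ₛ_ K (L (φ K p B)) (φ K p (L B))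
    log!-φ L (L-constant , exp!∘L , _) B B₀≈1 = coefficients
      where
      φB₀≈1 : φ K p B 0 ≈ 1#
      φB₀≈1 = trans (φ-multiple p B 0 ≡.refl) B₀≈1

      exp!-agree : _≈ₛ_ K (exp! K (L (φ K p B))) (exp! K (φ K p (L B)))
      exp!-agree m = trans (exp!∘L _ φB₀≈1 m) (sym (trans (exp!-φ (L B) m) (φ-cong p (exp!∘L B B₀≈1) m)))

      coefficients : _≈ₛ_ K (L (φ K p B)) (φ K p (L B))
      coefficients zero    = trans (L-constant _ φB₀≈1) (sym (trans (φ-multiple p (L B) 0 ≡.refl) (L-constant B B₀≈1)))
      coefficients (suc n) = exp!-injective _ _ exp!-agree n

corollary7p5 : ∀ {c ℓ : Level} (p : ℕ) → Prime p →
    (K : CommutativeRing c ℓ) → IsAlgebraicClosureOfFp K p →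
    ((A : Series K) → CommutativeRing._≈_ K (A 0) (CommutativeRing.0# K) →
      _≈ₛ_ K (exp! K (φ K p A)) (φ K p (exp! K A)))
    ×
    ((L : Series K → Series K) → IsLog! K L →
      (B : Series K) → CommutativeRing._≈_ K (B 0) (CommutativeRing.1# K) →
      _≈ₛ_ K (L (φ K p B)) (φ K p (L B)))
corollary7p5 zero    p-prime K _              = ⊥-elim (NonZero.nonZero (prime⇒nonZero p-prime))
corollary7p5 (suc r) p-prime K (_ , char , _) =
  (λ A _ → exp!-φ K p-prime char A) , log!-φ K p-prime char
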